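{- Let $M$ be a maximal planar graph or an $n$-semi-MPG with $n\ge 4$. If $M$ carries two coexisting single-color tilings among an R-tiling, a G-tiling and a B-tiling, then the third single-color tiling coexisting with them exists (so together they form an RGB-tiling), and there are no red odd-cycles, no green odd-cycles and no blue odd-cycles.
   Context: A maximal planar graph (MPG) is a simple plane graph all of whose faces, including the outer one, are triangles. An $n$-semi-MPG is a connected simple plane graph in which every face is a triangle except one designated face, the outer facet, which is an $n$-gon. An R-tiling (resp. G-tiling, B-tiling) is a set of edges, colored red (resp. green, blue), such that every triangular face other than the outer facet contains exactly one edge of that set; the other edges are called black for that tiling. Tilings of different colors coexist if no edge receives two colors, i.e. in every triangular face the distinguished edges of the different colors are distinct. An RGB-tiling is a coloring of all edges by red, green, blue such that every triangular face (other than the outer facet) has three differently colored edges. A red (green, blue) odd-cycle is a cycle of odd length all of whose edges are red (green, blue). -}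

module Defs where

open import Data.Nat using (ℕ; zero; suc; _+_; _<_; _≤_)
open import Data.Fin using (Fin; zero; suc; inject₁; fromℕ)
open import Data.Bool using (Bool; true; false)
open import Data.Product using (Σ; ∃; _×_; _,_)
open import Relation.Binary.PropositionalEquality using (_≡_; _≢_)
open import Relation.Nullary using (¬_)
open import Function.Bundles using (_⇔_)
open import Data.Unit using (⊤)

-- Plane graphs as combinatorial maps (rotation systems) of genus 0.
--   darts  : Fin D, α = edge involution (fixed-point free),
--   σ      = rotation around vertices (a permutation),
--   φ = σ ∘ α = face permutation; faces are the φ-orbits.  Planarity (sphere embedding) = connected and
-- Euler's formula V - E + F = 2.

iter : {A : Set} → ℕ → (A → A) → A → A
iter zero    f x = x
iter (suc k) f x = f (iter k f x)

data Reach {D : ℕ} (σ α : Fin D → Fin D) : Fin D → Fin D → Set where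
  here  : ∀ {d} → Reach σ α d d
  viaσ  : ∀ {d d'} → Reach σ α (σ d) d' → Reach σ α d d'
  viaα  : ∀ {d d'} → Reach σ α (α d) d' → Reach σ α d d'

record PlaneMap : Set where
  field
    D V E F  : ℕ
    α σ σ⁻¹  : Fin D → Fin D
    α-invol  : ∀ d → α (α d) ≡ d
    α-free   : ∀ d → α d ≢ d
    σσ⁻¹     : ∀ d → σ (σ⁻¹ d) ≡ d
    σ⁻¹σ     : ∀ d → σ⁻¹ (σ d) ≡ d
    darts    : D ≡ E + E
    vert     : Fin D → Fin V
    face     : Fin D → Fin F
    vert-surj : ∀ v → ∃ λ d → vert d ≡ v
    face-surj : ∀ f → ∃ λ d → face d ≡ f
    vert-orb  : ∀ d d' → (vert d ≡ vert d') ⇔ (∃ λ k → iter k σ d ≡ d')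
    face-orb  : ∀ d d' → (face d ≡ face d') ⇔ (∃ λ k → iter k (λ x → σ (α x)) d ≡ d')

  field
    connected : ∀ d d' → Reach σ α d d'
    euler     : V + F ≡ E + 2

  φ : Fin D → Fin D
  φ x = σ (α x)

  Simple : Set
  Simple = (∀ d → vert d ≢ vert (α d))
         × (∀ d d' → vert d ≡ vert d' → vert (α d) ≡ vert (α d') → d ≡ d')

  FaceLength : Fin D → ℕ → Set
  FaceLength d n = (iter n φ d ≡ d) × (∀ k → 0 < k → k < n → iter k φ d ≢ d)

  IsMPG : Set
  IsMPG = Simple × (∀ d → FaceLength d 3)

  IsSemiMPG : ℕ → Fin F → Set
  IsSemiMPG n o = Simple
    × (∀ d → face d ≡ o → FaceLength d n)
    × (∀ d → face d ≡ o → ∀ i j → i < n → j < n →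
         vert (iter i φ d) ≡ vert (iter j φ d) → i ≡ j)
    × (∀ d → face d ≢ o → FaceLength d 3)

open PlaneMap public

data Kind (M : PlaneMap) : Set where
  mpg  : IsMPG M → Kind M
  semi : (n : ℕ) → 4 ≤ n → (o : Fin (F M)) → IsSemiMPG M n o → Kind M

Inner : (M : PlaneMap) → Kind M → Fin (D M) → Set
Inner M (mpg _)        d = ⊤
Inner M (semi n _ o _) d = face M d ≢ o

b2n : Bool → ℕ
b2n true  = 1
b2n false = 0

-- an edge set: a predicate on darts invariant under α
-- single-colour tiling: every inner triangle has exactly one edge in the set
IsTiling : (M : PlaneMap) → Kind M → (Fin (D M) → Bool) → Set
IsTiling M k T = (∀ d → T (α M d) ≡ T d)
  × (∀ d → Inner M k d →
       b2n (T d) + b2n (T (φ M d)) + b2n (T (φ M (φ M d))) ≡ 1)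

Coexist : (M : PlaneMap) → (Fin (D M) → Bool) → (Fin (D M) → Bool) → Set
Coexist M T T' = ∀ d → ¬ (T d ≡ true × T' d ≡ true)

data Color : Set where
  red green blue : Color

IsRGB : (M : PlaneMap) → Kind M → (Fin (D M) → Color) → Set
IsRGB M k c = (∀ d → c (α M d) ≡ c d)
  × (∀ d → Inner M k d →
       (c d ≢ c (φ M d)) × (c (φ M d) ≢ c (φ M (φ M d))) × (c d ≢ c (φ M (φ M d))))

Odd : ℕ → Set
Odd n = ∃ λ j → n ≡ suc (j + j)

record Cycle (M : PlaneMap) (m : ℕ) : Set where
  field
    ds       : Fin (suc m) → Fin (D M)
    links    : ∀ (i : Fin m) → vert M (α M (ds (inject₁ i))) ≡ vert M (ds (suc i))
    closes   : vert M (α M (ds (fromℕ m))) ≡ vert M (ds zero)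
    distinct : ∀ i j → vert M (ds i) ≡ vert M (ds j) → i ≡ j

MonoOddCycle : (M : PlaneMap) → (Fin (D M) → Color) → Color → Set
MonoOddCycle M c col = Σ ℕ λ m → Odd (suc m) × Σ (Cycle M m) λ C →
  ∀ i → c (Cycle.ds C i) ≡ col

{-# OPTIONS --safe #-}
module Submission where

-- Paint a dart c₁ if it lies in T₁, c₂ if it lies in T₂ and the third colour otherwise; since
-- each inner triangle has exactly one edge of each tiling and they are disjoint, every inner
-- triangle becomes rainbow.  A monochromatic cycle consists of black edges of T₁ or of T₂.
-- For a single tiling T the black edges meet every inner triangle twice, so their indicator
-- is a cocycle mod 2; as H¹(S²; ℤ/2) = 0 it is a coboundary δx, i.e. the black edges are
-- exactly the edges crossing the cut defined by x, and a cycle of them has even length.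
-- A cocycle is shown to be a coboundary along a spanning tree: by Euler's formula the
-- remaining edges form a spanning tree of the dual graph, along which the residual
-- cocycle vanishes leaf by leaf.

open import Defs

open import Algebra.Bundles using (CommutativeRing)
open import Data.Bool using (Bool; true; false; not; _xor_)
import Data.Bool.Properties as Bool
open import Algebra.Properties.CommutativeSemigroup
  (CommutativeRing.+-commutativeSemigroup Bool.xor-∧-commutativeRing) using (interchange)
open import Data.Empty using (⊥; ⊥-elim; ⊥-elim-irr)
open import Data.Fin using (Fin; zero; suc; toℕ; fromℕ<; inject₁; fromℕ; splitAt; join; _≟_)
open import Data.Fin.Properties
  using (toℕ≤pred[n]; any?; all?; ¬∀⟶∃¬; pigeonhole; join-splitAt; injective⇒≤)
open import Data.Nat using (ℕ; zero; suc; _+_; _≤_; _<_; _≤′_; ≤′-refl; ≤′-step; z≤n; s≤s)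
import Data.Nat as ℕ
open import Data.Nat.Properties
  using (n≢0⇒n>0; +-comm; +-suc; suc-injective; n≤1+n; n<1+n; 1+n≰n; m≤m+n; ≤-reflexive;
         ≤-trans; ≤-pred; <-≤-trans; <-asym; <⇒≱; ≰⇒>; ≤⇒≤′; +-monoʳ-≤)
open import Data.Nat.Tactic.RingSolver using (solve-∀)
open import Data.Product using (Σ; ∃; _×_; _,_; proj₁; proj₂)
open import Data.Sum using (_⊎_; inj₁; inj₂; [_,_]′)
open import Data.Unit using (⊤; tt)
open import Function using (_∘_)
open import Function.Bundles using (Equivalence; _⇔_; mk⇔)
open import Function.Definitions using (Injective)
open import Level using (0ℓ)
open import Relation.Binary.PropositionalEquality
  using (_≡_; _≢_; refl; sym; trans; cong; cong₂; subst; subst₂; module ≡-Reasoning)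
open import Relation.Nullary using (¬_; Dec; yes; no; does)
open import Relation.Nullary.Decidable
  using (¬?; decidable-stable; dec-true; _⊎-dec_; _×-dec_; _→-dec_; map′)
open import Relation.Unary using (Pred; Decidable)

dec-true⁻¹ : ∀ {A : Set} (a? : Dec A) → does a? ≡ true → A
dec-true⁻¹ (yes a) _ = a

-- Breadth-first spanning trees

-- Nodes Fin n; the edges are given by darts e : Fin N leading from node e to node (rev e).
module SpanningTree {n N : ℕ} (node : Fin N → Fin n) (rev : Fin N → Fin N)
  (rev-involutive : ∀ e → rev (rev e) ≡ e)
  (Usable : Pred (Fin N) 0ℓ) (usable? : Decidable Usable) (root : Fin n)
  (connected : ∀ (X : Fin n → Bool) → X root ≡ true →
    (∀ e → Usable e → X (node e) ≡ true → X (node (rev e)) ≡ true) → ∀ v → X v ≡ true)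
  where

  Within : ℕ → Pred (Fin n) 0ℓ
  Within zero    v = v ≡ root
  Within (suc k) v = Within k v ⊎ ∃ λ e → Usable e × Within k (node e) × node (rev e) ≡ v

  within? : ∀ k → Decidable (Within k)
  within? zero    v = v ≟ root
  within? (suc k) v =
    within? k v ⊎-dec any? (λ e → usable? e ×-dec within? k (node e) ×-dec node (rev e) ≟ v)

  within-mono : ∀ {k j v} → k ≤ j → Within k v → Within j v
  within-mono = go ∘ ≤⇒≤′
    where
    go : ∀ {k j v} → k ≤′ j → Within k v → Within j v
    go ≤′-refl        w = w
    go (≤′-step k≤′j) w = inj₁ (go k≤′j w)

  Saturated : ℕ → Set
  Saturated k = ∀ v → Within (suc k) v → Within k v

  saturated-suc : ∀ {k} → Saturated k → Saturated (suc k)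
  saturated-suc sat v (inj₁ w)                 = w
  saturated-suc sat v (inj₂ (e , u , w , refl)) = inj₂ (e , u , sat (node e) w , refl)

  saturated-mono : ∀ {k j} → k ≤ j → Saturated k → Saturated j
  saturated-mono = go ∘ ≤⇒≤′
    where
    go : ∀ {k j} → k ≤′ j → Saturated k → Saturated j
    go ≤′-refl        sat = sat
    go (≤′-step k≤′j) sat = saturated-suc (go k≤′j sat)

  saturated? : ∀ k → Dec (Saturated k)
  saturated? k = all? λ v → within? (suc k) v →-dec within? k v

  new-node : ∀ k → ¬ Saturated k → ∃ λ v → Within (suc k) v × ¬ Within k v
  new-node k ¬sat with ¬∀⟶∃¬ n _ (λ v → within? (suc k) v →-dec within? k v) ¬sat
  ... | v , ¬imp with within? (suc k) v
  ...   | yes w = v , w , λ w′ → ¬imp (λ _ → w′)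
  ...   | no ¬w  = ⊥-elim (¬imp (⊥-elim ∘ ¬w))

  -- Each unsaturated layer contributes a new node; n + 1 of them would be too many.
  some-layer-saturated : ¬ (∀ (k : Fin (suc n)) → ¬ Saturated (toℕ k))
  some-layer-saturated ¬sat with pigeonhole (n<1+n n) (λ k → proj₁ (new-node (toℕ k) (¬sat k)))
  ... | i , j , i<j , same = proj₂ (proj₂ (new-node (toℕ j) (¬sat j)))
          (subst (Within (toℕ j)) same
            (within-mono i<j (proj₁ (proj₂ (new-node (toℕ i) (¬sat i))))))

  saturated-at-size : Saturated n
  saturated-at-size with any? (saturated? ∘ toℕ)
  ... | yes (k , sat) = saturated-mono (toℕ≤pred[n] k) sat
  ... | no ¬sat        = ⊥-elim (some-layer-saturated λ k sat → ¬sat (k , sat))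

  within-size : ∀ v → Within n v
  within-size v = dec-true⁻¹ (within? n v) (connected (λ u → does (within? n u))
    (dec-true (within? n root) (within-mono z≤n refl))
    (λ e u w → dec-true (within? n _)
      (saturated-at-size _ (inj₂ (e , u , dec-true⁻¹ (within? n (node e)) w , refl))))
    v)

  least : ∀ k v → Within k v → Σ ℕ λ j → Within j v × (∀ i → Within i v → j ≤ i)
  least zero    v w = 0 , w , λ _ _ → z≤n
  least (suc k) v w with within? k v
  ... | yes w′ = least k v w′
  ... | no ¬w  = suc k , w , λ i wi → ≰⇒> (λ i≤k → ¬w (within-mono i≤k wi))

  -- Opaque because unfolding the search while comparing terms makes type checking explode.
  opaque
    depth : Fin n → ℕ
    depth v = proj₁ (least n v (within-size v))

    within-depth : ∀ v → Within (depth v) v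
    within-depth v = proj₁ (proj₂ (least n v (within-size v)))

    depth-least : ∀ v i → Within i v → depth v ≤ i
    depth-least v = proj₂ (proj₂ (least n v (within-size v)))

    depth≤size : ∀ v → depth v ≤ n
    depth≤size v = depth-least v n (within-size v)

    private
      parentEdge : ∀ v → .(v ≢ root) → ∀ k → Within k v → (∀ i → Within i v → k ≤ i) →
                   ∃ λ e → Usable e × node (rev e) ≡ v × depth (node e) < k
      parentEdge v v≢r zero    w                       _     = ⊥-elim-irr (v≢r w)
      parentEdge v v≢r (suc k) (inj₁ w)                minim = ⊥-elim (1+n≰n (minim k w))
      parentEdge v v≢r (suc k) (inj₂ (e , u , w , t)) _     =
        e , u , t , s≤s (depth-least (node e) k w)

      parentWithEdge : ∀ v → .(v ≢ root) →
                       ∃ λ e → Usable e × node (rev e) ≡ v × depth (node e) < depth v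
      parentWithEdge v v≢r = parentEdge v v≢r (depth v) (within-depth v) (depth-least v)

    parent : (v : Fin n) → .(v ≢ root) → Fin N
    parent v v≢r = proj₁ (parentWithEdge v v≢r)

    parent-usable : ∀ v (v≢r : v ≢ root) → Usable (parent v v≢r)
    parent-usable v v≢r = proj₁ (proj₂ (parentWithEdge v v≢r))

    parent-target : ∀ v (v≢r : v ≢ root) → node (rev (parent v v≢r)) ≡ v
    parent-target v v≢r = proj₁ (proj₂ (proj₂ (parentWithEdge v v≢r)))

    parent-closer : ∀ v (v≢r : v ≢ root) → depth (node (parent v v≢r)) < depth v
    parent-closer v v≢r = proj₂ (proj₂ (proj₂ (parentWithEdge v v≢r)))

  parent-injective : ∀ {v v′} (v≢r : v ≢ root) (v′≢r : v′ ≢ root) →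
                     parent v v≢r ≡ parent v′ v′≢r → v ≡ v′
  parent-injective {v} {v′} v≢r v′≢r eq =
    trans (sym (parent-target v v≢r)) (trans (cong (node ∘ rev) eq) (parent-target v′ v′≢r))

  parent≢rev-parent : ∀ {v v′} (v≢r : v ≢ root) (v′≢r : v′ ≢ root) →
                      parent v v≢r ≢ rev (parent v′ v′≢r)
  parent≢rev-parent {v} {v′} v≢r v′≢r eq = <-asym v′<v v<v′
    where
    v′<v : depth v′ < depth v
    v′<v = subst (λ u → depth u < depth v) (trans (cong node eq) (parent-target v′ v′≢r))
                 (parent-closer v v≢r)
    v<v′ : depth v < depth v′
    v<v′ = subst (λ u → depth u < depth v′)
                 (trans (cong node (sym (trans (cong rev eq) (rev-involutive _))))
                        (parent-target v v≢r))
                 (parent-closer v′ v′≢r)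

  rev-parent-determined : ∀ {c u e} (c≢r : c ≢ root) (u≢r : u ≢ root) →
                          parent c c≢r ≡ rev e → node e ≡ u → e ≡ rev (parent u u≢r)
  rev-parent-determined {c} c≢r u≢r pc≡re refl
    with e≡rev-pc ← trans (sym (rev-involutive _)) (cong rev (sym pc≡re))
    with refl ← trans (sym (parent-target c c≢r)) (cong node (sym e≡rev-pc))
    = e≡rev-pc

  IsParent : Pred (Fin N) 0ℓ
  IsParent e = ∃ λ v → Σ (v ≢ root) λ v≢r → parent v v≢r ≡ e

  isParent? : Decidable IsParent
  isParent? e = any? parentOf?
    where
    parentOf? : ∀ v → Dec (Σ (v ≢ root) λ v≢r → parent v v≢r ≡ e)
    parentOf? v with v ≟ root
    ... | yes refl = no λ (v≢r , _) → v≢r refl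
    ... | no v≢r   = map′ (v≢r ,_) proj₂ (parent v v≢r ≟ e)

  -- Children are deeper than their parent, and depths are bounded by n.
  upward-induction : ∀ {ℓ} (P : Pred (Fin n) ℓ) →
    (∀ v → (∀ c (c≢r : c ≢ root) → node (parent c c≢r) ≡ v → P c) → P v) → ∀ v → P v
  upward-induction P step v = go n v (m≤m+n n (depth v))
    where
    deeper : ∀ {v} c (c≢r : c ≢ root) → node (parent c c≢r) ≡ v → depth v < depth c
    deeper c c≢r refl = parent-closer c c≢r
    go : ∀ k v → n ≤ k + depth v → P v
    go zero    v bound = step v λ c c≢r p →
      ⊥-elim (<⇒≱ (deeper c c≢r p) (≤-trans (depth≤size c) bound))
    go (suc k) v bound = step v λ c c≢r p →
      go k c (≤-trans bound (≤-trans (≤-reflexive (sym (+-suc k (depth v))))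
                                     (+-monoʳ-≤ k (deeper c c≢r p))))

  module TreeRecursion {A : Set} (atRoot : A) (step : (v : Fin n) → .(v ≢ root) → A → A) where

    opaque
      private
        unfold : ℕ → Fin n → A
        unfold zero    v = atRoot
        unfold (suc k) v with v ≟ root
        ... | yes _   = atRoot
        ... | no v≢r = step v v≢r (unfold k (node (parent v v≢r)))

        unfold-enough : ∀ k j v → depth v < k → depth v < j → unfold k v ≡ unfold j v
        unfold-enough (suc k) (suc j) v dk dj with v ≟ root
        ... | yes _   = refl
        ... | no v≢r = cong (step v v≢r) (unfold-enough k j _
                (<-≤-trans (parent-closer v v≢r) (≤-pred dk))
                (<-≤-trans (parent-closer v v≢r) (≤-pred dj)))

      treeRec : Fin n → A
      treeRec = unfold (suc n)

      treeRec-parent : ∀ v (v≢r : v ≢ root) → treeRec v ≡ step v v≢r (treeRec (node (parent v v≢r)))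
      treeRec-parent v v≢r with v ≟ root
      ... | yes v≡r = ⊥-elim (v≢r v≡r)
      ... | no _    = cong (step v v≢r) (unfold-enough n (suc n) _
              (<-≤-trans (parent-closer v v≢r) (depth≤size v)) (s≤s (depth≤size _)))

-- Counting half-edges

splitAt-injective : ∀ m {k} {x y : Fin (m + k)} → splitAt m x ≡ splitAt m y → x ≡ y
splitAt-injective m {k} {x} {y} eq =
  trans (sym (join-splitAt m k x)) (trans (cong (join m k) eq) (join-splitAt m k y))

[,]∘splitAt-injective : ∀ {m k N} {f : Fin m → Fin N} {g : Fin k → Fin N} →
  Injective _≡_ _≡_ f → Injective _≡_ _≡_ g → (∀ i j → f i ≢ g j) →
  Injective _≡_ _≡_ ([ f , g ]′ ∘ splitAt m)
[,]∘splitAt-injective {m} f-inj g-inj f≢g {x} {y} eq with splitAt m x in ex | splitAt m y in ey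
... | inj₁ i | inj₁ j = splitAt-injective m (trans ex (trans (cong inj₁ (f-inj eq)) (sym ey)))
... | inj₂ i | inj₂ j = splitAt-injective m (trans ex (trans (cong inj₂ (g-inj eq)) (sym ey)))
... | inj₁ i | inj₂ j = ⊥-elim (f≢g i j eq)
... | inj₂ i | inj₁ j = ⊥-elim (f≢g j i (sym eq))

module HalfEdges {N : ℕ} (a : Fin N → Fin N) (a-involutive : ∀ x → a (a x) ≡ x) where

  a-injective : Injective _≡_ _≡_ a
  a-injective {x} {y} eq = trans (sym (a-involutive x)) (trans (cong a eq) (a-involutive y))

  Selection : ∀ {m} → (Fin m → Fin N) → Set
  Selection π = Injective _≡_ _≡_ π × (∀ i j → π i ≢ a (π j))

  selection-size : ∀ {m} {π : Fin m → Fin N} → Selection π → m + m ≤ N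
  selection-size {m} {π} (π-inj , π≢aπ) =
    injective⇒≤ ([,]∘splitAt-injective {f = π} {g = a ∘ π} π-inj (π-inj ∘ a-injective) π≢aπ)

  selection-++ : ∀ {m k} {f : Fin m → Fin N} {g : Fin k → Fin N} → Selection f → Selection g →
    (∀ i j → f i ≢ g j) → (∀ i j → f i ≢ a (g j)) → Selection ([ f , g ]′ ∘ splitAt m)
  selection-++ {m} {f = f} {g} (f-inj , f≢af) (g-inj , g≢ag) f≢g f≢ag =
    [,]∘splitAt-injective f-inj g-inj f≢g , apart
    where
    apart : ∀ x y → [ f , g ]′ (splitAt m x) ≢ a ([ f , g ]′ (splitAt m y))
    apart x y with splitAt m x | splitAt m y
    ... | inj₁ i | inj₁ j = f≢af i j
    ... | inj₂ i | inj₂ j = g≢ag i j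
    ... | inj₁ i | inj₂ j = f≢ag i j
    ... | inj₂ i | inj₁ j = λ eq → f≢ag j i (trans (sym (a-involutive _)) (cong a (sym eq)))

module _ {n N : ℕ} (root : Fin n) (atRoot : Fin N) (f : (v : Fin n) → .(v ≢ root) → Fin N) where

  extend : Fin n → Fin N
  extend v with v ≟ root
  ... | yes _   = atRoot
  ... | no v≢r = f v v≢r

  extend-view : ∀ v → (v ≡ root × extend v ≡ atRoot) ⊎ Σ (v ≢ root) λ v≢r → extend v ≡ f v v≢r
  extend-view v with v ≟ root
  ... | yes v≡r = inj₁ (v≡r , refl)
  ... | no v≢r  = inj₂ (v≢r , refl)

extend-rel : ∀ {n₁ n₂ N} {r₁ : Fin n₁} {r₂ : Fin n₂} {ρ₁ ρ₂ : Fin N}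
  {f₁ : (v : Fin n₁) → .(v ≢ r₁) → Fin N} {f₂ : (w : Fin n₂) → .(w ≢ r₂) → Fin N}
  (R : Fin n₁ → Fin n₂ → Fin N → Fin N → Set) →
  R r₁ r₂ ρ₁ ρ₂ →
  (∀ w (w≢r : w ≢ r₂) → R r₁ w ρ₁ (f₂ w w≢r)) →
  (∀ v (v≢r : v ≢ r₁) → R v r₂ (f₁ v v≢r) ρ₂) →
  (∀ v (v≢r : v ≢ r₁) w (w≢r : w ≢ r₂) → R v w (f₁ v v≢r) (f₂ w w≢r)) →
  ∀ v w → R v w (extend r₁ ρ₁ f₁ v) (extend r₂ ρ₂ f₂ w)
extend-rel {r₁ = r₁} {r₂} {ρ₁} {ρ₂} {f₁} {f₂} R rr rf fr ff v w
  with extend-view r₁ ρ₁ f₁ v | extend-view r₂ ρ₂ f₂ w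
... | inj₁ (refl , p)   | inj₁ (refl , q)   = subst₂ (R _ _) (sym p) (sym q) rr
... | inj₁ (refl , p)   | inj₂ (w≢r , q) = subst₂ (R _ _) (sym p) (sym q) (rf w w≢r)
... | inj₂ (v≢r , p) | inj₁ (refl , q)   = subst₂ (R _ _) (sym p) (sym q) (fr v v≢r)
... | inj₂ (v≢r , p) | inj₂ (w≢r , q) = subst₂ (R _ _) (sym p) (sym q) (ff v v≢r w w≢r)

-- Cocycles on a plane map are coboundaries

iter-comm : ∀ {A : Set} k (f : A → A) x → iter k f (f x) ≡ f (iter k f x)
iter-comm zero    f x = refl
iter-comm (suc k) f x = cong f (iter-comm k f x)

orbit-change : ∀ {N} (f : Fin N → Fin N) (g : Fin N → Bool) (Q : Pred (Fin N) 0ℓ) →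
  (∀ z → Q z → Q (f z)) → ∀ {x} k y → Q y → iter k f y ≡ x → g y ≢ g x →
  ∃ λ z → Q z × z ≢ x × g z ≢ g (f z)
orbit-change f g Q Q-f zero    y Qy refl gy≢gx = ⊥-elim (gy≢gx refl)
orbit-change f g Q Q-f {x} (suc k) y Qy p gy≢gx with y ≟ x | g y Bool.≟ g (f y)
... | yes refl | _        = ⊥-elim (gy≢gx refl)
... | no y≢x  | no change = y , Qy , y≢x , change
... | no y≢x  | yes same  =
  orbit-change f g Q Q-f k (f y) (Q-f y Qy) (trans (iter-comm k f y) p) (λ e → gy≢gx (trans same e))

module PlaneMapProperties (M : PlaneMap) where

  vert-σ : ∀ d → vert M (σ M d) ≡ vert M d
  vert-σ d = sym (Equivalence.from (vert-orb M d (σ M d)) (1 , refl))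

  α-swap : ∀ {d e} → d ≡ α M e → e ≡ α M d
  α-swap {d} {e} eq = trans (sym (α-invol M e)) (cong (α M) (sym eq))

  face-φ : ∀ d → face M (φ M d) ≡ face M d
  face-φ d = sym (Equivalence.from (face-orb M d (φ M d)) (1 , refl))

  face-α≡face-σ : ∀ d → face M (α M d) ≡ face M (σ M d)
  face-α≡face-σ d = Equivalence.from (face-orb M (α M d) (σ M d)) (1 , cong (σ M) (α-invol M d))

  rotation-closes : ∀ d → ∃ λ k → iter k (σ M) (σ M d) ≡ d
  rotation-closes d = Equivalence.to (vert-orb M (σ M d) d) (vert-σ d)

faceSum : (M : PlaneMap) → (Fin (D M) → Bool) → Fin (D M) → Bool
faceSum M w d = w d xor (w (φ M d) xor w (φ M (φ M d)))

δ : (M : PlaneMap) → (Fin (V M) → Bool) → Fin (D M) → Bool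
δ M x d = x (vert M d) xor x (vert M (α M d))

faceSum-xor : ∀ M (u w : Fin (D M) → Bool) d →
  faceSum M (λ e → u e xor w e) d ≡ faceSum M u d xor faceSum M w d
faceSum-xor M u w d = trans (cong ((u d xor w d) xor_) (interchange (u d₁) (w d₁) (u d₂) (w d₂)))
                              (interchange (u d) (w d) (u d₁ xor u d₂) (w d₁ xor w d₂))
  where
  d₁ = φ M d
  d₂ = φ M d₁

xor≡false⇒≡ : ∀ {x y} → x xor y ≡ false → x ≡ y
xor≡false⇒≡ {false} {false} _ = refl
xor≡false⇒≡ {true}  {true}  _ = refl

module Coboundary (M : PlaneMap) (outer : Fin (F M))
  (triangular : ∀ d → face M d ≢ outer → FaceLength M d 3) where

  open PlaneMapProperties M

  d₀ : Fin (D M)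
  d₀ = proj₁ (face-surj M outer)

  r : Fin (V M)
  r = vert M d₀

  vertices-connected : ∀ (X : Fin (V M) → Bool) → X r ≡ true →
    (∀ e → ⊤ → X (vert M e) ≡ true → X (vert M (α M e)) ≡ true) → ∀ v → X v ≡ true
  vertices-connected X Xr closed v =
    subst (λ u → X u ≡ true) (proj₂ (vert-surj M v)) (along (connected M d₀ _) Xr)
    where
    along : ∀ {d d′} → Reach (σ M) (α M) d d′ → X (vert M d) ≡ true → X (vert M d′) ≡ true
    along here         x = x
    along (viaσ {d} p) x = along p (subst (λ u → X u ≡ true) (sym (vert-σ d)) x)
    along (viaα {d} p) x = along p (closed d tt x)

  module Primal = SpanningTree (vert M) (α M) (α-invol M) (λ _ → ⊤) (λ _ → yes tt) r vertices-connected

  TreeDart : Pred (Fin (D M)) 0ℓ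
  TreeDart d = Primal.IsParent d ⊎ Primal.IsParent (α M d)

  treeDart? : Decidable TreeDart
  treeDart? d = Primal.isParent? d ⊎-dec Primal.isParent? (α M d)

  treeDart-α : ∀ {d} → TreeDart d → TreeDart (α M d)
  treeDart-α {d} (inj₁ p) = inj₂ (subst Primal.IsParent (sym (α-invol M d)) p)
  treeDart-α     (inj₂ p) = inj₁ p

  -- The dual of a spanning tree's complement is connected: the boundary of a set of faces
  -- consists of tree edges and meets each vertex an even number of times, impossible in a tree.
  module _ (X : Fin (F M) → Bool) (X-outer : X outer ≡ true)
    (closed : ∀ e → ¬ TreeDart e → X (face M e) ≡ true → X (face M (α M e)) ≡ true) where

    private
      side : Fin (D M) → Bool
      side d = X (face M d)

      Crosses : Pred (Fin (D M)) 0ℓ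
      Crosses d = side d ≢ side (α M d)

      crosses-α : ∀ {d} → Crosses d → Crosses (α M d)
      crosses-α {d} cr eq = cr (sym (trans eq (cong side (α-invol M d))))

      crosses⇒tree : ∀ {d} → Crosses d → TreeDart d
      crosses⇒tree {d} cr with treeDart? d
      ... | yes tree = tree
      ... | no ¬tree = ⊥-elim (cr (Bool.⇔→≡ (mk⇔ (closed d ¬tree)
              (subst (λ e → side e ≡ true) (α-invol M d) ∘ closed (α M d) ¬tree-α))))
        where
        ¬tree-α : ¬ TreeDart (α M d)
        ¬tree-α = ¬tree ∘ subst TreeDart (α-invol M d) ∘ treeDart-α

      side-α : ∀ d → side (α M d) ≡ side (σ M d)
      side-α d = cong X (face-α≡face-σ d)

      another-crossing : ∀ e → Crosses e → ∃ λ z → vert M z ≡ vert M e × z ≢ e × Crosses z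
      another-crossing e cr with orbit-change (σ M) side (λ z → vert M z ≡ vert M e)
          (λ z p → trans (vert-σ z) p) (proj₁ (rotation-closes e)) (σ M e) (vert-σ e)
          (proj₂ (rotation-closes e)) (λ eq → cr (trans (sym eq) (sym (side-α e))))
      ... | z , z-at-e , z≢e , change = z , z-at-e , z≢e , λ eq → change (trans eq (side-α z))

      -- The second crossing at u that a crossing parent edge of u forces must be the parent
      -- edge of a child of u.
      ¬crosses-parent : ∀ u (u≢r : u ≢ r) → ¬ Crosses (Primal.parent u u≢r)
      ¬crosses-parent = Primal.upward-induction _ step
        where
        step : ∀ u → (∀ c (c≢r : c ≢ r) → vert M (Primal.parent c c≢r) ≡ u →
                        ∀ (c≢r′ : c ≢ r) → ¬ Crosses (Primal.parent c c≢r′)) →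
               ∀ (u≢r : u ≢ r) → ¬ Crosses (Primal.parent u u≢r)
        step u children u≢r cr
          with another-crossing (α M (Primal.parent u u≢r)) (crosses-α cr)
        ... | z , z-at-u , z≢e₀ , crz with crosses⇒tree crz
        ...   | inj₁ (c , c≢r , refl) =
          children c c≢r (trans z-at-u (Primal.parent-target u u≢r)) c≢r crz
        ...   | inj₂ (c , c≢r , pc≡αz) =
          z≢e₀ (Primal.rev-parent-determined c≢r u≢r pc≡αz (trans z-at-u (Primal.parent-target u u≢r)))

      ¬crosses : ∀ d → ¬ Crosses d
      ¬crosses d cr with crosses⇒tree cr
      ... | inj₁ (u , u≢r , refl)  = ¬crosses-parent u u≢r cr
      ... | inj₂ (u , u≢r , pu≡αd) =
        ¬crosses-parent u u≢r (subst Crosses (sym pu≡αd) (crosses-α cr))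

    faces-connected : ∀ f → X f ≡ true
    faces-connected f = subst (λ g → X g ≡ true) (proj₂ (face-surj M f))
      (along (connected M d₀ _) (subst (λ g → X g ≡ true) (sym (proj₂ (face-surj M outer))) X-outer))
      where
      side-α≡side : ∀ d → side (α M d) ≡ side d
      side-α≡side d = sym (decidable-stable (side d Bool.≟ side (α M d)) (¬crosses d))
      along : ∀ {d d′} → Reach (σ M) (α M) d d′ → side d ≡ true → side d′ ≡ true
      along here         x = x
      along (viaσ {d} p) x = along p (trans (sym (side-α d)) (trans (side-α≡side d) x))
      along (viaα {d} p) x = along p (trans (side-α≡side d) x)

  module Dual = SpanningTree (face M) (α M) (α-invol M) (λ e → ¬ TreeDart e) (λ e → ¬? (treeDart? e))
                             outer faces-connected

  CotreeDart : Pred (Fin (D M)) 0ℓ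
  CotreeDart d = Dual.IsParent d ⊎ Dual.IsParent (α M d)

  -- An edge {d, α d} outside both trees, the V − 1 tree edges, the F − 1 cotree edges and a
  -- dummy edge {0, 1} for the root (hence Fin (2 + D)) are V + F = E + 2 distinct edges
  -- among the E + 1 edges of Fin (2 + D).
  module _ (d : Fin (D M)) (¬tree : ¬ TreeDart d) (¬cotree : ¬ CotreeDart d) where
    private
      pad : Fin (D M) → Fin (2 + D M)
      pad e = suc (suc e)

      pad-injective : ∀ {e e′} → pad e ≡ pad e′ → e ≡ e′
      pad-injective refl = refl

      flip : Fin (2 + D M) → Fin (2 + D M)
      flip zero          = suc zero
      flip (suc zero)    = zero
      flip (suc (suc e)) = pad (α M e)

      flip-involutive : ∀ x → flip (flip x) ≡ x
      flip-involutive zero          = refl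
      flip-involutive (suc zero)    = refl
      flip-involutive (suc (suc e)) = cong pad (α-invol M e)

      open HalfEdges flip flip-involutive

      treeEdges : Fin (V M) → Fin (2 + D M)
      treeEdges = extend r zero λ v v≢r → pad (Primal.parent v v≢r)

      cotreeEdges : Fin (F M) → Fin (2 + D M)
      cotreeEdges = extend outer (pad d) λ f f≢o → pad (Dual.parent f f≢o)

      treeEdges-selection : Selection treeEdges
      treeEdges-selection =
        (λ {v} {w} → extend-rel (λ v w x y → x ≡ y → v ≡ w) (λ _ → refl) (λ _ _ ()) (λ _ _ ())
                       (λ _ v≢r _ w≢r → Primal.parent-injective v≢r w≢r ∘ pad-injective) v w)
        , extend-rel (λ _ _ x y → x ≢ flip y) (λ ()) (λ _ _ ()) (λ _ _ ())
            (λ _ v≢r _ w≢r → Primal.parent≢rev-parent v≢r w≢r ∘ pad-injective)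

      cotreeEdges-selection : Selection cotreeEdges
      cotreeEdges-selection =
        (λ {f} {g} → extend-rel (λ f g x y → x ≡ y → f ≡ g) (λ _ → refl)
           (λ g g≢o eq → ⊥-elim (¬cotree (inj₁ (g , g≢o , sym (pad-injective eq)))))
           (λ f f≢o eq → ⊥-elim (¬cotree (inj₁ (f , f≢o , pad-injective eq))))
           (λ _ f≢o _ g≢o → Dual.parent-injective f≢o g≢o ∘ pad-injective) f g)
        , extend-rel (λ _ _ x y → x ≢ flip y) (α-free M d ∘ sym ∘ pad-injective)
            (λ g g≢o eq → ¬cotree (inj₂ (g , g≢o , α-swap (pad-injective eq))))
            (λ f f≢o eq → ¬cotree (inj₂ (f , f≢o , pad-injective eq)))
            (λ _ f≢o _ g≢o → Dual.parent≢rev-parent f≢o g≢o ∘ pad-injective)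

      tree≢cotree : ∀ v w → treeEdges v ≢ cotreeEdges w
      tree≢cotree = extend-rel (λ _ _ x y → x ≢ y) (λ ()) (λ _ _ ())
        (λ v v≢r eq → ¬tree (inj₁ (v , v≢r , pad-injective eq)))
        (λ v v≢r w w≢o eq → Dual.parent-usable w w≢o (inj₁ (v , v≢r , pad-injective eq)))

      tree≢flip-cotree : ∀ v w → treeEdges v ≢ flip (cotreeEdges w)
      tree≢flip-cotree = extend-rel (λ _ _ x y → x ≢ flip y) (λ ()) (λ _ _ ())
        (λ v v≢r eq → ¬tree (inj₂ (v , v≢r , pad-injective eq)))
        (λ v v≢r w w≢o eq → Dual.parent-usable w w≢o (inj₂ (v , v≢r , pad-injective eq)))

    uncovered-impossible : ⊥
    uncovered-impossible = 1+n≰n (≤-trans (n≤1+n (3 + D M)) (≤-trans (≤-reflexive count) bound))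
      where
      bound : (V M + F M) + (V M + F M) ≤ 2 + D M
      bound = selection-size (selection-++ treeEdges-selection cotreeEdges-selection
                                           tree≢cotree tree≢flip-cotree)
      open ≡-Reasoning
      double-plus-two : ∀ e → 4 + (e + e) ≡ (e + 2) + (e + 2)
      double-plus-two = solve-∀
      count : 2 + (2 + D M) ≡ (V M + F M) + (V M + F M)
      count = begin
        4 + D M                   ≡⟨ cong (4 +_) (darts M) ⟩
        4 + (E M + E M)           ≡⟨ double-plus-two (E M) ⟩
        (E M + 2) + (E M + 2)     ≡⟨ sym (cong₂ _+_ (euler M) (euler M)) ⟩
        (V M + F M) + (V M + F M) ∎

  cotreeDart? : Decidable CotreeDart
  cotreeDart? d = Dual.isParent? d ⊎-dec Dual.isParent? (α M d)

  tree-or-cotree : ∀ d → TreeDart d ⊎ CotreeDart d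
  tree-or-cotree d = decidable-stable (treeDart? d ⊎-dec cotreeDart? d)
    λ ¬covered → uncovered-impossible d (¬covered ∘ inj₁) (¬covered ∘ inj₂)

  δ-closed : ∀ x d → face M d ≢ outer → faceSum M (δ M x) d ≡ false
  δ-closed x d d∉o = telescope (cong x (vert-σ (α M d))) (cong x (vert-σ (α M (φ M d))))
    (cong x (trans (sym (vert-σ (α M (φ M (φ M d))))) (cong (vert M) (proj₁ (triangular d d∉o)))))
    where
    telescope : ∀ {a b c a′ b′ c′} → b′ ≡ b → c′ ≡ c → a′ ≡ a →
                (a xor b) xor ((b′ xor c) xor (c′ xor a′)) ≡ false
    telescope {false} {false} {false} refl refl refl = refl
    telescope {false} {false} {true}  refl refl refl = refl
    telescope {false} {true}  {false} refl refl refl = refl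
    telescope {false} {true}  {true}  refl refl refl = refl
    telescope {true}  {false} {false} refl refl refl = refl
    telescope {true}  {false} {true}  refl refl refl = refl
    telescope {true}  {true}  {false} refl refl refl = refl
    telescope {true}  {true}  {true}  refl refl refl = refl

  module _ (w : Fin (D M) → Bool) (w-α : ∀ d → w (α M d) ≡ w d)
           (w-closed : ∀ d → face M d ≢ outer → faceSum M w d ≡ false) where

    open Primal.TreeRecursion false (λ v v≢r x → x xor w (Primal.parent v v≢r))
      renaming (treeRec to potential; treeRec-parent to potential-parent)

    private
      residual : Fin (D M) → Bool
      residual d = w d xor δ M potential d

      residual-α : ∀ d → residual (α M d) ≡ residual d
      residual-α d = cong₂ _xor_ (w-α d)
        (trans (cong (λ e → potential (vert M (α M d)) xor potential (vert M e)) (α-invol M d))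
               (Bool.xor-comm (potential (vert M (α M d))) (potential (vert M d))))

      residual-parent : ∀ v (v≢r : v ≢ r) → residual (Primal.parent v v≢r) ≡ false
      residual-parent v v≢r = begin
        w p xor (potential (vert M p) xor potential (vert M (α M p)))
          ≡⟨ cong (λ u → w p xor (potential (vert M p) xor potential u)) (Primal.parent-target v v≢r) ⟩
        w p xor (potential (vert M p) xor potential v)
          ≡⟨ cong (λ b → w p xor (potential (vert M p) xor b)) (potential-parent v v≢r) ⟩
        w p xor (potential (vert M p) xor (potential (vert M p) xor w p))
          ≡⟨ cong (w p xor_) (sym (Bool.xor-assoc (potential (vert M p)) _ _)) ⟩
        w p xor ((potential (vert M p) xor potential (vert M p)) xor w p)
          ≡⟨ cong (λ b → w p xor (b xor w p)) (Bool.xor-same (potential (vert M p))) ⟩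
        w p xor w p
          ≡⟨ Bool.xor-same (w p) ⟩
        false ∎
        where
        open ≡-Reasoning
        p = Primal.parent v v≢r

      residual-tree : ∀ {d} → TreeDart d → residual d ≡ false
      residual-tree (inj₁ (v , v≢r , refl))  = residual-parent v v≢r
      residual-tree {d} (inj₂ (v , v≢r , pv≡αd)) =
        trans (sym (residual-α d)) (subst (λ e → residual e ≡ false) pv≡αd (residual-parent v v≢r))

      residual-closed : ∀ d → face M d ≢ outer → faceSum M residual d ≡ false
      residual-closed d d∉o = trans (faceSum-xor M w (δ M potential) d)
        (cong₂ _xor_ (w-closed d d∉o) (δ-closed potential d d∉o))

      -- Leaves first: the two other sides of the triangle beyond a cotree edge are tree edges
      -- or cotree edges of children, so the face sum forces the residual there to vanish too.
      residual-cotree-parent : ∀ f (f≢o : f ≢ outer) → residual (Dual.parent f f≢o) ≡ false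
      residual-cotree-parent = Dual.upward-induction _ step
        where
        step : ∀ f → (∀ g (g≢o : g ≢ outer) → face M (Dual.parent g g≢o) ≡ f →
                        ∀ (g≢o′ : g ≢ outer) → residual (Dual.parent g g≢o′) ≡ false) →
               ∀ (f≢o : f ≢ outer) → residual (Dual.parent f f≢o) ≡ false
        step f children f≢o =
          trans (cong residual (sym (α-invol M _))) (trans (residual-α e₀) residual-e₀)
          where
          e₀ = α M (Dual.parent f f≢o)
          e₀-in-f : face M e₀ ≡ f
          e₀-in-f = Dual.parent-target f f≢o
          e₀∉o : face M e₀ ≢ outer
          e₀∉o eq = f≢o (trans (sym e₀-in-f) eq)
          other-side : ∀ e → face M e ≡ f → e ≢ e₀ → residual e ≡ false
          other-side e e-in-f e≢e₀ with tree-or-cotree e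
          ... | inj₁ tree = residual-tree tree
          ... | inj₂ (inj₁ (g , g≢o , refl)) = children g g≢o e-in-f g≢o
          ... | inj₂ (inj₂ (g , g≢o , pg≡αe)) =
            ⊥-elim (e≢e₀ (Dual.rev-parent-determined g≢o f≢o pg≡αe e-in-f))
          φ-in-f : ∀ k → face M (iter k (φ M) e₀) ≡ f
          φ-in-f zero    = e₀-in-f
          φ-in-f (suc k) = trans (face-φ _) (φ-in-f k)
          residual-e₀ : residual e₀ ≡ false
          residual-e₀ = trans (sym (Bool.xor-identityʳ (residual e₀)))
            (subst₂ (λ b c → residual e₀ xor (b xor c) ≡ false)
              (other-side _ (φ-in-f 1) (proj₂ (triangular e₀ e₀∉o) 1 (s≤s z≤n) (s≤s (s≤s z≤n))))
              (other-side _ (φ-in-f 2) (proj₂ (triangular e₀ e₀∉o) 2 (s≤s z≤n) (s≤s (s≤s (s≤s z≤n)))))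
              (residual-closed e₀ e₀∉o))

      residual-zero : ∀ d → residual d ≡ false
      residual-zero d with tree-or-cotree d
      ... | inj₁ tree                      = residual-tree tree
      ... | inj₂ (inj₁ (f , f≢o , refl))  = residual-cotree-parent f f≢o
      ... | inj₂ (inj₂ (f , f≢o , pf≡αd)) = trans (sym (residual-α d))
              (subst (λ e → residual e ≡ false) pf≡αd (residual-cotree-parent f f≢o))

    cocycle⇒coboundary : ∃ λ x → ∀ d → w d ≡ δ M x d
    cocycle⇒coboundary = potential , λ d → xor≡false⇒≡ (residual-zero d)

-- Odd cycles and colourings

alternating-end : ∀ m (g : Fin (suc m) → Bool) → (∀ i → g (suc i) ≡ not (g (inject₁ i))) →
  g (fromℕ m) ≡ iter m not (g zero)
alternating-end zero    g alt = refl
alternating-end (suc m) g alt =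
  trans (alt (fromℕ m)) (cong not (alternating-end m (g ∘ inject₁) (alt ∘ inject₁)))

iter-not-even : ∀ j b → iter (j + j) not b ≡ b
iter-not-even zero    b = refl
iter-not-even (suc j) b =
  trans (cong (λ k → not (iter k not b)) (+-suc j j)) (trans (Bool.not-involutive _) (iter-not-even j b))

xor≡true⇒≡not : ∀ {x y} → x xor y ≡ true → y ≡ not x
xor≡true⇒≡not {false} {true}  _ = refl
xor≡true⇒≡not {true}  {false} _ = refl

cut-cycle-even : ∀ M {m} (x : Fin (V M) → Bool) (C : Cycle M m) →
  (∀ i → δ M x (Cycle.ds C i) ≡ true) → ¬ Odd (suc m)
cut-cycle-even M {m} x C crossing (j , odd) = Bool.not-¬ refl (trans (g-zero) (cong not g-end))
  where
  open Cycle C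
  g : Fin (suc m) → Bool
  g i = x (vert M (ds i))
  flips : ∀ i → x (vert M (α M (ds i))) ≡ not (g i)
  flips i = xor≡true⇒≡not (crossing i)
  g-zero : g zero ≡ not (g (fromℕ m))
  g-zero = trans (cong x (sym closes)) (flips (fromℕ m))
  g-end : g (fromℕ m) ≡ g zero
  g-end = trans (alternating-end m g (λ i → trans (cong x (sym (links i))) (flips (inject₁ i))))
                (subst (λ k → iter k not (g zero) ≡ g zero) (sym (suc-injective odd))
                       (iter-not-even j (g zero)))

record OuterFacet (M : PlaneMap) (k : Kind M) : Set where
  field
    outer      : Fin (F M)
    triangular : ∀ d → face M d ≢ outer → FaceLength M d 3
    inner      : ∀ d → face M d ≢ outer → Inner M k d

-- A maximal planar graph has no designated outer facet; any face will do.
someFace : (M : PlaneMap) → Fin (F M)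
someFace M with V M ℕ.≟ 0
... | no V≢0  = face M (proj₁ (vert-surj M (fromℕ< (n≢0⇒n>0 V≢0))))
... | yes V≡0 =
  subst Fin (trans (+-comm 2 (E M)) (sym (trans (cong (_+ F M) (sym V≡0)) (euler M)))) zero

outerFacet : (M : PlaneMap) (k : Kind M) → OuterFacet M k
outerFacet M (mpg (_ , triangles)) =
  record { outer = someFace M ; triangular = λ d _ → triangles d ; inner = λ _ _ → tt }
outerFacet M (semi _ _ o (_ , _ , _ , triangles)) =
  record { outer = o ; triangular = triangles ; inner = λ _ d∉o → d∉o }

data ExactlyOne : Bool → Bool → Bool → Set where
  first  : ExactlyOne true  false false
  second : ExactlyOne false true  false
  third  : ExactlyOne false false true

exactlyOne : ∀ a b c → b2n a + b2n b + b2n c ≡ 1 → ExactlyOne a b c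
exactlyOne true  false false _  = first
exactlyOne false true  false _  = second
exactlyOne false false true  _  = third
exactlyOne true  true  _     ()
exactlyOne true  false true  ()
exactlyOne false true  true  ()
exactlyOne false false false ()

exactlyOne-not-xor : ∀ {a b c} → ExactlyOne a b c → not a xor (not b xor not c) ≡ false
exactlyOne-not-xor first  = refl
exactlyOne-not-xor second = refl
exactlyOne-not-xor third  = refl

black-cycle-even : ∀ M k (T : Fin (D M) → Bool) → IsTiling M k T → ∀ {m} (C : Cycle M m) →
  (∀ i → T (Cycle.ds C i) ≡ false) → ¬ Odd (suc m)
black-cycle-even M k T (T-α , T-one) C black =
  cut-cycle-even M x C λ i → trans (sym (black≡δx (Cycle.ds C i))) (cong not (black i))
  where
  open OuterFacet (outerFacet M k)
  open Coboundary M outer triangular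
  closed : ∀ d → face M d ≢ outer → faceSum M (not ∘ T) d ≡ false
  closed d d∉o =
    exactlyOne-not-xor (exactlyOne (T d) (T (φ M d)) (T (φ M (φ M d))) (T-one d (inner d d∉o)))
  x : Fin (V M) → Bool
  x = proj₁ (cocycle⇒coboundary (not ∘ T) (cong not ∘ T-α) closed)
  black≡δx : ∀ d → not (T d) ≡ δ M x d
  black≡δx = proj₂ (cocycle⇒coboundary (not ∘ T) (cong not ∘ T-α) closed)

otherColour : (c₁ c₂ : Color) → ∃ λ c₃ → c₃ ≢ c₁ × c₃ ≢ c₂
otherColour red   red   = green , (λ ()) , (λ ())
otherColour red   green = blue  , (λ ()) , (λ ())
otherColour red   blue  = green , (λ ()) , (λ ())
otherColour green red   = blue  , (λ ()) , (λ ())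
otherColour green green = red   , (λ ()) , (λ ())
otherColour green blue  = red   , (λ ()) , (λ ())
otherColour blue  red   = green , (λ ()) , (λ ())
otherColour blue  green = red   , (λ ()) , (λ ())
otherColour blue  blue  = red   , (λ ()) , (λ ())

Rainbow : Color → Color → Color → Set
Rainbow x y z = (x ≢ y) × (y ≢ z) × (x ≢ z)

module Painting {c₁ c₂ c₃ : Color} (c₁≢c₂ : c₁ ≢ c₂) (c₃≢c₁ : c₃ ≢ c₁) (c₃≢c₂ : c₃ ≢ c₂) where

  paint : Bool → Bool → Color
  paint true  _     = c₁
  paint false true  = c₂
  paint false false = c₃

  paint≡c₁ : ∀ a b → (paint a b ≡ c₁) ⇔ (a ≡ true)
  paint≡c₁ true  _     = mk⇔ (λ _ → refl) (λ _ → refl)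
  paint≡c₁ false true  = mk⇔ (⊥-elim ∘ c₁≢c₂ ∘ sym) λ ()
  paint≡c₁ false false = mk⇔ (⊥-elim ∘ c₃≢c₁) λ ()

  paint-injectiveˡ : ∀ {a b a′ b′} → paint a b ≡ paint a′ b′ → a ≡ a′
  paint-injectiveˡ {a} {b} {a′} {b′} eq = Bool.⇔→≡ (mk⇔
    (λ a-true → Equivalence.to (paint≡c₁ a′ b′) (trans (sym eq) (Equivalence.from (paint≡c₁ a b) a-true)))
    (λ a′-true → Equivalence.to (paint≡c₁ a b) (trans eq (Equivalence.from (paint≡c₁ a′ b′) a′-true))))

  paint≡c₂ : ∀ a b → ¬ (a ≡ true × b ≡ true) → (paint a b ≡ c₂) ⇔ (b ≡ true)
  paint≡c₂ true  true  disjoint = ⊥-elim (disjoint (refl , refl))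
  paint≡c₂ true  false _        = mk⇔ (⊥-elim ∘ c₁≢c₂) λ ()
  paint≡c₂ false true  _        = mk⇔ (λ _ → refl) (λ _ → refl)
  paint≡c₂ false false _        = mk⇔ (⊥-elim ∘ c₃≢c₂) λ ()

  paint-rainbow : ∀ {a₀ a₁ a₂ b₀ b₁ b₂} → ExactlyOne a₀ a₁ a₂ → ExactlyOne b₀ b₁ b₂ →
    ¬ (a₀ ≡ true × b₀ ≡ true) → ¬ (a₁ ≡ true × b₁ ≡ true) → ¬ (a₂ ≡ true × b₂ ≡ true) →
    Rainbow (paint a₀ b₀) (paint a₁ b₁) (paint a₂ b₂)
  paint-rainbow first  first  disjoint _ _ = ⊥-elim (disjoint (refl , refl))
  paint-rainbow first  second _ _ _ = c₁≢c₂ , c₃≢c₂ ∘ sym , c₃≢c₁ ∘ sym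
  paint-rainbow first  third  _ _ _ = c₃≢c₁ ∘ sym , c₃≢c₂ , c₁≢c₂
  paint-rainbow second first  _ _ _ = c₁≢c₂ ∘ sym , c₃≢c₁ ∘ sym , c₃≢c₂ ∘ sym
  paint-rainbow second second _ disjoint _ = ⊥-elim (disjoint (refl , refl))
  paint-rainbow second third  _ _ _ = c₃≢c₁ , c₁≢c₂ , c₃≢c₂
  paint-rainbow third  first  _ _ _ = c₃≢c₂ ∘ sym , c₃≢c₁ , c₁≢c₂ ∘ sym
  paint-rainbow third  second _ _ _ = c₃≢c₂ , c₁≢c₂ ∘ sym , c₃≢c₁
  paint-rainbow third  third  _ _ disjoint = ⊥-elim (disjoint (refl , refl))

module TwoTilings (M : PlaneMap) (k : Kind M) {c₁ c₂ : Color} (c₁≢c₂ : c₁ ≢ c₂)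
  {T₁ T₂ : Fin (D M) → Bool} (tiling₁ : IsTiling M k T₁) (tiling₂ : IsTiling M k T₂)
  (coexist : Coexist M T₁ T₂) where

  open Painting c₁≢c₂ (proj₁ (proj₂ (otherColour c₁ c₂))) (proj₂ (proj₂ (otherColour c₁ c₂)))

  colour : Fin (D M) → Color
  colour d = paint (T₁ d) (T₂ d)

  colour-rgb : IsRGB M k colour
  colour-rgb = (λ d → cong₂ paint (proj₁ tiling₁ d) (proj₁ tiling₂ d)) , λ d inner →
    paint-rainbow (exactlyOne _ _ _ (proj₂ tiling₁ d inner)) (exactlyOne _ _ _ (proj₂ tiling₂ d inner))
                  (coexist d) (coexist (φ M d)) (coexist (φ M (φ M d)))

  colour≡c₁ : ∀ d → (colour d ≡ c₁) ⇔ (T₁ d ≡ true)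
  colour≡c₁ d = paint≡c₁ (T₁ d) (T₂ d)

  colour≡c₂ : ∀ d → (colour d ≡ c₂) ⇔ (T₂ d ≡ true)
  colour≡c₂ d = paint≡c₂ (T₁ d) (T₂ d) (coexist d)

  T₁-constant : ∀ {m col} (C : Cycle M m) → (∀ i → colour (Cycle.ds C i) ≡ col) →
                ∀ i → T₁ (Cycle.ds C i) ≡ T₁ (Cycle.ds C zero)
  T₁-constant C mono i = paint-injectiveˡ (trans (mono i) (sym (mono zero)))

  no-mono-odd-cycle : ∀ col → ¬ MonoOddCycle M colour col
  no-mono-odd-cycle col (m , odd , C , mono) with T₁ (Cycle.ds C zero) in T₁-start
  ... | true  = black-cycle-even M k T₂ tiling₂ C (λ i → Bool.¬-not λ T₂-i →
                  coexist (Cycle.ds C i) (trans (T₁-constant C mono i) T₁-start , T₂-i)) odd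
  ... | false = black-cycle-even M k T₁ tiling₁ C (λ i → trans (T₁-constant C mono i) T₁-start) odd

corollary6p9 : (M : PlaneMap) (k : Kind M) (c₁ c₂ : Color) → c₁ ≢ c₂ →
    (T₁ T₂ : Fin (D M) → Bool) → IsTiling M k T₁ → IsTiling M k T₂ → Coexist M T₁ T₂ →
    Σ (Fin (D M) → Color) λ c → IsRGB M k c
      × (∀ d → (c d ≡ c₁) ⇔ (T₁ d ≡ true))
      × (∀ d → (c d ≡ c₂) ⇔ (T₂ d ≡ true))
      × (∀ col → ¬ MonoOddCycle M c col)
corollary6p9 M k c₁ c₂ c₁≢c₂ T₁ T₂ tiling₁ tiling₂ coexist =
  colour , colour-rgb , colour≡c₁ , colour≡c₂ , no-mono-odd-cycle
  where open TwoTilings M k c₁≢c₂ tiling₁ tiling₂ coexist
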